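{- For $9\leq t\leq 20$ we have $rx_3(K_{2,t})=5$, and $rx_3(K_{2,t})\geq 6$ for every $t\geq 21$.
   Context: All graphs are simple, finite and undirected. In an edge-colored graph $G$ (adjacent edges may share colors), a tree is a rainbow tree if no two of its edges have the same color; for $S\subseteq V(G)$, an $S$-tree is a tree in $G$ containing all vertices of $S$. A $3$-rainbow coloring of $G$ is an edge coloring such that for every set $S$ of $3$ vertices there is a rainbow $S$-tree. The $3$-rainbow index $rx_3(G)$ is the minimum number of colors in a $3$-rainbow coloring of $G$. $K_{2,t}$ is the complete bipartite graph with parts of sizes $2$ and $t$. -}

module Defs where

open import Data.Nat using (ℕ; _<_; _≤_)
open import Data.Fin using (Fin; toℕ)
open import Data.Product using (Σ; ∃; _×_; _,_)
open import Data.Sum using (_⊎_)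
open import Data.List using (List; []; _∷_; length)
open import Data.List.Membership.Propositional using (_∈_)
open import Data.List.Relation.Unary.All using (All)
open import Data.List.Relation.Unary.Unique.Propositional using (Unique)
open import Data.List.Relation.Unary.AllPairs using (AllPairs)
open import Relation.Nullary using (¬_)
open import Relation.Binary.PropositionalEquality using (_≡_; _≢_)

record Graph (n : ℕ) : Set₁ where
  field
    Adj    : Fin n → Fin n → Set
    sym    : ∀ {u v} → Adj u v → Adj v u
    irrefl : ∀ {u} → ¬ Adj u u
open Graph public

-- K_{2,t}: vertices 0,1 form the part of size 2, vertices 2..t+1 the part of size t.
K2 : (t : ℕ) → Graph (2 Data.Nat.+ t)
K2 t = record
  { Adj    = λ u v → (toℕ u < 2 × 2 ≤ toℕ v) ⊎ (2 ≤ toℕ u × toℕ v < 2)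
  ; sym    = λ { (Data.Sum.inj₁ (a , b)) → Data.Sum.inj₂ (b , a)
               ; (Data.Sum.inj₂ (a , b)) → Data.Sum.inj₁ (b , a) }
  ; irrefl = λ { (Data.Sum.inj₁ (a , b)) → Data.Nat.Properties.<⇒≱ a b
               ; (Data.Sum.inj₂ (a , b)) → Data.Nat.Properties.<⇒≱ b a }
  }
  where import Data.Nat.Properties

-- An edge colouring with (at most) k colours: a symmetric colour assignment to
-- pairs of vertices; only its values on edges matter.
record Colouring {n : ℕ} (G : Graph n) (k : ℕ) : Set where
  field
    col    : Fin n → Fin n → Fin k
    colSym : ∀ u v → col u v ≡ col v u
open Colouring public

Edge : ℕ → Set
Edge n = Fin n × Fin n

EdgeIn : ∀ {n} → List (Edge n) → Fin n → Fin n → Set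
EdgeIn E u v = (u , v) ∈ E ⊎ (v , u) ∈ E

SameEdge : ∀ {n} → Edge n → Edge n → Set
SameEdge (a , b) (c , d) = ((a ≡ c) × (b ≡ d)) ⊎ ((a ≡ d) × (b ≡ c))

data Walk {n : ℕ} (E : List (Edge n)) : Fin n → Fin n → Set where
  here : ∀ {u} → Walk E u u
  step : ∀ {u w v} → EdgeIn E u w → Walk E w v → Walk E u v

Consecutive : ∀ {n} → List (Edge n) → List (Fin n) → Set
Consecutive E [] = Data.Unit.⊤
  where import Data.Unit
Consecutive E (u ∷ []) = Data.Unit.⊤
  where import Data.Unit
Consecutive E (u ∷ v ∷ vs) = EdgeIn E u v × Consecutive E (v ∷ vs)

last? : ∀ {n} → Fin n → List (Fin n) → Fin n
last? x [] = x
last? x (y ∷ ys) = last? y ys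

Cycle : ∀ {n} → List (Edge n) → Set
Cycle {n} E = Σ (Fin n) λ v₀ → Σ (List (Fin n)) λ vs →
  (2 ≤ length vs) × Unique (v₀ ∷ vs) × Consecutive E (v₀ ∷ vs)
  × EdgeIn E (last? v₀ vs) v₀

record IsTree {n : ℕ} (G : Graph n) (V : List (Fin n)) (E : List (Edge n)) : Set where
  field
    nonempty  : 1 ≤ length V
    vDistinct : Unique V
    eDistinct : AllPairs (λ e f → ¬ SameEdge e f) E
    edgesOfG  : All (λ e → Adj G (Data.Product.proj₁ e) (Data.Product.proj₂ e)) E
    endpoints : All (λ e → Data.Product.proj₁ e ∈ V × Data.Product.proj₂ e ∈ V) E
    connected : ∀ {u v} → u ∈ V → v ∈ V → Walk E u v
    acyclic   : ¬ Cycle E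

Rainbow : ∀ {n k} {G : Graph n} → Colouring G k → List (Edge n) → Set
Rainbow c E = AllPairs (λ e f → col c (Data.Product.proj₁ e) (Data.Product.proj₂ e)
                              ≢ col c (Data.Product.proj₁ f) (Data.Product.proj₂ f)) E

RainbowSTree : ∀ {n k} (G : Graph n) → Colouring G k → Fin n → Fin n → Fin n → Set
RainbowSTree {n} G c x y z = Σ (List (Fin n)) λ V → Σ (List (Edge n)) λ E →
  IsTree G V E × x ∈ V × y ∈ V × z ∈ V × Rainbow c E

Is3Rainbow : ∀ {n k} (G : Graph n) → Colouring G k → Set
Is3Rainbow {n} G c = (x y z : Fin n) → x ≢ y → y ≢ z → x ≢ z → RainbowSTree G c x y z

Has3RainbowColouring : ∀ {n} → Graph n → ℕ → Set
Has3RainbowColouring G k = Σ (Colouring G k) λ c → Is3Rainbow G c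

Rx3≡ : ∀ {n} → Graph n → ℕ → Set
Rx3≡ G k = Has3RainbowColouring G k × (∀ j → j < k → ¬ Has3RainbowColouring G j)

Rx3≥ : ∀ {n} → Graph n → ℕ → Set
Rx3≥ G k = ∀ j → Has3RainbowColouring G j → k ≤ j

-- The profile of a leaf is the pair of colours of its edges to the two
-- centres.  A rainbow tree through three leaves is a star at one centre, or
-- it passes between the centres through one of them, or through a fourth
-- leaf (five edges, so five colours): the Shapes.  Lower bounds: a separation
-- splits the profiles with colours below K into m classes, no three profiles
-- of one class admitting a shape; for t > 2m three leaves share a class
-- (pigeonhole₃), contradicting the shape a 3-rainbow colouring forces.
-- Separations for (K, m) = (4, 4) and (5, 10) are checked by evaluation.
-- Upper bound: a table of profiles for 20 leaves; stars and spiders (a hub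
-- leaf joined to both centres plus pendant legs), shown to be trees by an
-- acyclicity criterion for K_{2,t}, serve every triple by a checked search.
module Submission where

open import Defs
open import Data.Nat using (ℕ; _≤_)
open import Data.Product using (_×_)
open import Data.Nat using (zero; suc; _+_; _*_; _∸_; _<_; _≡ᵇ_; _<ᵇ_; _≤ᵇ_; _⊔_; _≟_; _≤?_; _<?_; s≤s; z≤n)
open import Data.Nat.DivMod using (_%_; _/_)
open import Data.Nat.Properties
  using ( ≡ᵇ⇒≡; ≡⇒≡ᵇ; <ᵇ⇒<; ≤ᵇ⇒≤; ≤∧≢⇒<; ≤-pred; ≤-trans; <-≤-trans; ≤-<-trans; <⇒≱; ≮⇒≥; ≰⇒>
        ; +-suc; +-cancelˡ-<; +-monoˡ-≤; ⊔-lub; module ≤-Reasoning)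
open import Data.Bool using (Bool; true; false; not; _∧_; _∨_; T)
open import Data.Bool.Properties using (T-∧; T-∨)
open import Data.Bool.ListAction using (all; any)
open import Data.Fin using (Fin; toℕ; fromℕ<; #_) renaming (zero to fzero; suc to fsuc)
open import Data.Fin.Properties using (injective⇒≤; toℕ<n; toℕ-injective; toℕ-fromℕ<) renaming (_≟_ to _≟ᶠ_)
open import Data.Product using (Σ; ∃; _,_; proj₁; proj₂)
open import Data.Sum using (_⊎_; inj₁; inj₂)
open import Data.List using (List; []; _∷_; _++_; length; lookup; map; concatMap; filter; upTo; allFin; cartesianProduct)
open import Data.List.Properties using (length-map; length-tabulate)
open import Data.List.Membership.Propositional using (_∈_; _∉_)
open import Data.List.Membership.Propositional.Properties using (∈-lookup; ∈-filter⁻; ∈-upTo⁺; ∈-map⁺; ∈-map⁻; ∈-cartesianProduct⁺)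
open import Data.List.Relation.Unary.Any using (here; there; satisfied)
open import Data.List.Relation.Unary.Any.Properties using (any⁻)
open import Data.List.Relation.Unary.All as All using (All; []; _∷_)
open import Data.List.Relation.Unary.All.Properties using (all⁺; all⁻)
import Data.List.Relation.Unary.All.Properties as Allₚ
open import Data.List.Relation.Unary.AllPairs as AllPairs using (AllPairs; []; _∷_)
import Data.List.Relation.Unary.AllPairs.Properties as AllPairsₚ
open import Data.List.Relation.Unary.Unique.Propositional using (Unique)
open import Data.List.Relation.Unary.Unique.Propositional.Properties using (filter⁺; allFin⁺)
open import Data.Empty using (⊥; ⊥-elim)
open import Function using (Equivalence; _∘_)
open import Level using (0ℓ)
open import Relation.Nullary using (¬_; yes; no)
open import Relation.Unary using (Pred; Decidable)
open import Relation.Unary.Properties using (∁?)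
open import Relation.Binary.PropositionalEquality as ≡ using (_≡_; _≢_; refl; trans; cong; subst)

distinct : List ℕ → Bool
distinct []       = true
distinct (x ∷ xs) = all (λ y → not (x ≡ᵇ y)) xs ∧ distinct xs

not-T : ∀ {b} → T (not b) → ¬ T b
not-T {true}  ()
not-T {false} _ ()

not-≡ᵇ-sound : ∀ x y → T (not (x ≡ᵇ y)) → x ≢ y
not-≡ᵇ-sound x .x x≢ᵇx refl = not-T x≢ᵇx (≡⇒≡ᵇ x x refl)

not-≡ᵇ-complete : ∀ x y → x ≢ y → T (not (x ≡ᵇ y))
not-≡ᵇ-complete x y x≢y with x ≡ᵇ y in eq
... | false = _
... | true  = x≢y (≡ᵇ⇒≡ x y (subst T (≡.sym eq) _))

distinct-sound : ∀ xs → T (distinct xs) → AllPairs _≢_ xs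
distinct-sound []       _  = []
distinct-sound (x ∷ xs) ok with Equivalence.to T-∧ ok
... | head , tail = All.map (not-≡ᵇ-sound x _) (all⁺ _ xs head) ∷ distinct-sound xs tail

distinct-complete : ∀ {xs} → AllPairs _≢_ xs → T (distinct xs)
distinct-complete {[]}     []         = _
distinct-complete {x ∷ xs} (x∉ ∷ xs!) =
  Equivalence.from T-∧ (all⁻ _ (All.map (not-≡ᵇ-complete x _) x∉) , distinct-complete xs!)

all-upTo : ∀ (f : ℕ → Bool) n → T (all f (upTo n)) → ∀ {i} → i < n → T (f i)
all-upTo f n ok i<n = All.lookup (all⁺ f (upTo n) ok) (∈-upTo⁺ i<n)

all-upTo² : ∀ (f : ℕ → ℕ → Bool) n → T (all (λ i → all (f i) (upTo n)) (upTo n)) →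
            ∀ {i j} → i < n → j < n → T (f i j)
all-upTo² f n ok i<n = all-upTo (f _) n (all-upTo (λ i → all (f i) (upTo n)) n ok i<n)

all-upTo³ : ∀ (f : ℕ → ℕ → ℕ → Bool) n →
            T (all (λ i → all (λ j → all (f i j) (upTo n)) (upTo n)) (upTo n)) →
            ∀ {i j l} → i < n → j < n → l < n → T (f i j l)
all-upTo³ f n ok i<n j<n = all-upTo (f _ _) n (all-upTo² (λ i j → all (f i j) (upTo n)) n ok i<n j<n)

distinct⇒length≤ : ∀ {n} {xs : List (Fin n)} → AllPairs _≢_ xs → length xs ≤ n
distinct⇒length≤ xs! = injective⇒≤ (lookup-injective xs!)
  where
  lookup-injective : ∀ {A : Set} {xs : List A} → AllPairs _≢_ xs →
                     ∀ {i k} → lookup xs i ≡ lookup xs k → i ≡ k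
  lookup-injective (x∉ ∷ _)   {fzero} {fzero}  _ = refl
  lookup-injective (x∉ ∷ _)   {fzero} {fsuc k} e = ⊥-elim (All.lookup x∉ (∈-lookup k) e)
  lookup-injective (x∉ ∷ _)   {fsuc i} {fzero} e = ⊥-elim (All.lookup x∉ (∈-lookup i) (≡.sym e))
  lookup-injective (_ ∷ xs!)  {fsuc i} {fsuc k} e = cong fsuc (lookup-injective xs! e)

unique-map : ∀ {A B : Set} {f : A → B} {xs} → Unique (map f xs) →
             ∀ {x y} → x ∈ xs → y ∈ xs → f x ≡ f y → x ≡ y
unique-map {f = f} (_  ∷ _)   (here refl) (here refl) _  = refl
unique-map {f = f} (x∉ ∷ _)   (here refl) (there y∈)  eq = ⊥-elim (All.lookup x∉ (∈-map⁺ f y∈) eq)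
unique-map {f = f} (y∉ ∷ _)   (there x∈)  (here refl) eq = ⊥-elim (All.lookup y∉ (∈-map⁺ f x∈) (≡.sym eq))
unique-map         (_  ∷ fs!) (there x∈)  (there y∈)  eq = unique-map fs! x∈ y∈ eq

length-filter-∁ : ∀ {A : Set} {P : Pred A 0ℓ} (P? : Decidable P) xs →
                  length (filter P? xs) + length (filter (∁? P?) xs) ≡ length xs
length-filter-∁ P? []       = refl
length-filter-∁ P? (x ∷ xs) with P? x
... | yes _ = cong suc (length-filter-∁ P? xs)
... | no  _ = trans (+-suc _ _) (cong suc (length-filter-∁ P? xs))

module _ {A : Set} (f : A → ℕ) where

  record Triple (xs : List A) : Set where
    constructor triple
    field
      {p q r}   : A
      members   : p ∈ xs × q ∈ xs × r ∈ xs
      different : p ≢ q × q ≢ r × p ≢ r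
      sameValue : f p ≡ f q × f q ≡ f r

  hasValue : ∀ k → Decidable (λ x → f x ≡ k)
  hasValue k x = f x ≟ k

  -- If f maps a duplicate-free list into [0, m) and the list is longer than
  -- 2m, some value is taken three times.  The elements with value m - 1
  -- either supply three already, or at most two of them are dropped and the
  -- rest, still longer than 2(m - 1), lands in [0, m - 1).
  pigeonhole₃ : ∀ m (xs : List A) → Unique xs → All (λ x → f x < m) xs →
                m + m < length xs → Triple xs
  pigeonhole₃ zero    []      _  _        ()
  pigeonhole₃ zero    (_ ∷ _) _  (() ∷ _) _
  pigeonhole₃ (suc m) xs      xs! below long with 3 ≤? length (filter (hasValue m) xs)
  ... | yes three = threeOf (filter⁺ _ xs!) (∈-filter⁻ _) three
    where
    threeOf : ∀ {ys} → Unique ys → (∀ {y} → y ∈ ys → y ∈ xs × f y ≡ m) →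
              3 ≤ length ys → Triple xs
    threeOf {_ ∷ []}     _ _ (s≤s ())
    threeOf {_ ∷ _ ∷ []} _ _ (s≤s (s≤s ()))
    threeOf {a ∷ b ∷ c ∷ _} ((a≢b ∷ a≢c ∷ _) ∷ (b≢c ∷ _) ∷ _) mem _ =
      triple (proj₁ (mem (here refl)) , proj₁ (mem (there (here refl))) ,
              proj₁ (mem (there (there (here refl)))))
             (a≢b , b≢c , a≢c)
             (trans (proj₂ (mem (here refl))) (≡.sym (proj₂ (mem (there (here refl))))) ,
              trans (proj₂ (mem (there (here refl)))) (≡.sym (proj₂ (mem (there (there (here refl)))))))
  ... | no ¬three = inRest (pigeonhole₃ m rest (filter⁺ _ xs!) restBelow restLong)
    where
    rest = filter (∁? (hasValue m)) xs

    restBelow : All (λ x → f x < m) rest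
    restBelow = All.tabulate λ x∈ → let x∈xs , fx≢m = ∈-filter⁻ (∁? (hasValue m)) x∈
                                    in ≤∧≢⇒< (≤-pred (All.lookup below x∈xs)) fx≢m

    restLong : m + m < length rest
    restLong = +-cancelˡ-< 2 (m + m) (length rest) (begin-strict
      2 + (m + m)                                 ≡⟨ cong suc (≡.sym (+-suc m m)) ⟩
      suc m + suc m                               <⟨ long ⟩
      length xs                                   ≡⟨ ≡.sym (length-filter-∁ (hasValue m) xs) ⟩
      length (filter (hasValue m) xs) + length rest ≤⟨ +-monoˡ-≤ (length rest) (≤-pred (≰⇒> ¬three)) ⟩
      2 + length rest                             ∎)
      where open ≤-Reasoning

    inRest : Triple rest → Triple xs
    inRest (triple (p∈ , q∈ , r∈) ≢s ≡s) =
      triple (proj₁ (∈-filter⁻ _ p∈) , proj₁ (∈-filter⁻ _ q∈) , proj₁ (∈-filter⁻ _ r∈)) ≢s ≡s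

module _ {n : ℕ} {E : List (Edge n)} where

  EdgeIn-sym : ∀ {u v} → EdgeIn E u v → EdgeIn E v u
  EdgeIn-sym (inj₁ uv) = inj₂ uv
  EdgeIn-sym (inj₂ vu) = inj₁ vu

  _++ʷ_ : ∀ {u v w} → Walk E u v → Walk E v w → Walk E u w
  here       ++ʷ q = q
  step e p   ++ʷ q = step e (p ++ʷ q)

  reverseʷ : ∀ {u v} → Walk E u v → Walk E v u
  reverseʷ here       = here
  reverseʷ (step e p) = reverseʷ p ++ʷ step (EdgeIn-sym e) here

  via-root : ∀ {V : List (Fin n)} {root} → (∀ {v} → v ∈ V → Walk E v root) →
             ∀ {u v} → u ∈ V → v ∈ V → Walk E u v
  via-root toRoot u∈ v∈ = toRoot u∈ ++ʷ reverseʷ (toRoot v∈)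

module K2 (t : ℕ) where

  Vertex : Set
  Vertex = Fin (2 + t)

  Ed : Set
  Ed = Edge (2 + t)

  cen : Bool → Vertex
  cen false = fzero
  cen true  = fsuc fzero

  leaf : Fin t → Vertex
  leaf a = fsuc (fsuc a)

  cen-injective : ∀ {s s'} → cen s ≡ cen s' → s ≡ s'
  cen-injective {false} {false} _ = refl
  cen-injective {true}  {true}  _ = refl

  cen≢leaf : ∀ s a → cen s ≢ leaf a
  cen≢leaf false _ ()
  cen≢leaf true  _ ()

  leaf-injective : ∀ {a b} → leaf a ≡ leaf b → a ≡ b
  leaf-injective refl = refl

  data Kind : Vertex → Set where
    centre : ∀ s → Kind (cen s)
    leafK  : ∀ a → Kind (leaf a)

  kind : ∀ v → Kind v
  kind fzero           = centre false
  kind (fsuc fzero)    = centre true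
  kind (fsuc (fsuc a)) = leafK a

  IsCentre IsLeaf : Vertex → Set
  IsCentre u = toℕ u < 2
  IsLeaf   u = 2 ≤ toℕ u

  centre-not-leaf : ∀ {u} → IsCentre u → ¬ IsLeaf u
  centre-not-leaf = <⇒≱

  leaf-isLeaf : ∀ a → IsLeaf (leaf a)
  leaf-isLeaf a = s≤s (s≤s z≤n)

  cen-isCentre : ∀ s → IsCentre (cen s)
  cen-isCentre false = s≤s z≤n
  cen-isCentre true  = s≤s (s≤s z≤n)

  centre-cen : ∀ {u} → IsCentre u → Σ Bool λ s → u ≡ cen s
  centre-cen {fzero}           _ = false , refl
  centre-cen {fsuc fzero}      _ = true , refl
  centre-cen {fsuc (fsuc _)} (s≤s (s≤s ()))

  no-three-centres : ∀ {u v w} → IsCentre u → IsCentre v → IsCentre w →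
                     u ≢ v → v ≢ w → u ≢ w → ⊥
  no-three-centres cu cv cw u≢v v≢w u≢w
    with centre-cen cu | centre-cen cv | centre-cen cw
  ... | false , refl | false , refl | _            = u≢v refl
  ... | true  , refl | true  , refl | _            = u≢v refl
  ... | _            | false , refl | false , refl = v≢w refl
  ... | _            | true  , refl | true  , refl = v≢w refl
  ... | false , refl | _            | false , refl = u≢w refl
  ... | true  , refl | _            | true  , refl = u≢w refl

  adj-leaf : ∀ {u v} → Adj (K2 t) u v → IsLeaf u → IsCentre v
  adj-leaf (inj₁ (cu , _)) lu = ⊥-elim (centre-not-leaf cu lu)
  adj-leaf (inj₂ (_ , cv)) _  = cv

  adj-centre : ∀ {u v} → Adj (K2 t) u v → IsCentre u → IsLeaf v
  adj-centre (inj₁ (_ , lv)) _  = lv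
  adj-centre (inj₂ (lu , _)) cu = ⊥-elim (centre-not-leaf cu lu)

  InG : List Ed → Set
  InG E = All (λ e → Adj (K2 t) (proj₁ e) (proj₂ e)) E

  edge-adj : ∀ {E u v} → InG E → EdgeIn E u v → Adj (K2 t) u v
  edge-adj inG (inj₁ uv) = All.lookup inG uv
  edge-adj inG (inj₂ vu) = Graph.sym (K2 t) (All.lookup inG vu)

  Both : List Ed → Vertex → Set
  Both E u = EdgeIn E u (cen false) × EdgeIn E u (cen true)

  between : ∀ {E c u c'} → IsCentre c → IsCentre c' → c ≢ c' →
            EdgeIn E c u → EdgeIn E u c' → Both E u
  between cc cc' c≢c' cu uc' with centre-cen cc | centre-cen cc'
  ... | false , refl | false , refl = ⊥-elim (c≢c' refl)
  ... | false , refl | true  , refl = EdgeIn-sym cu , uc'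
  ... | true  , refl | false , refl = uc' , EdgeIn-sym cu
  ... | true  , refl | true  , refl = ⊥-elim (c≢c' refl)

  AtMostOneBoth : List Ed → Set
  AtMostOneBoth E = ∀ {u v} → IsLeaf u → IsLeaf v → Both E u → Both E v → u ≡ v

  -- Along a cycle of K_{2,t} centres and leaves
  -- alternate and there are only two centres, so every cycle is
  -- c , x , c' , y with leaves x ≠ y both joined to c ≠ c'.
  acyclic : ∀ {E} → InG E → AtMostOneBoth E → ¬ Cycle E
  acyclic _ _ (_ , []         , () , _)
  acyclic _ _ (_ , _ ∷ []     , s≤s () , _)
  acyclic {E} inG oneBoth (v₀ , v₁ ∷ v₂ ∷ vs , _ , vs! , (e₀₁ , e₁₂ , path) , close)
    with toℕ v₁ <? 2
  ... | yes c₁ = centreSecond vs vs! path close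
    where
    -- v₁ is a centre, so v₀, v₂, v₄, … are leaves and v₃, v₅, … centres:
    -- closing a cycle of odd length joins two leaves, one of length 4 gives
    -- two leaves v₀ ≠ v₂ joined to both centres, and a longer one contains
    -- three different centres v₁, v₃, v₅.
    l₀ = adj-centre (Graph.sym (K2 t) (edge-adj inG e₀₁)) c₁
    l₂ = adj-centre (edge-adj inG e₁₂) c₁
    centreSecond : ∀ vs → Unique (v₀ ∷ v₁ ∷ v₂ ∷ vs) → Consecutive E (v₂ ∷ vs) →
                   EdgeIn E (last? v₂ vs) v₀ → ⊥
    centreSecond [] _ _ close = centre-not-leaf (adj-leaf (edge-adj inG close) l₂) l₀
    centreSecond (v₃ ∷ []) ((_ ∷ v₀≢v₂ ∷ _) ∷ (_ ∷ v₁≢v₃ ∷ []) ∷ _) (e₂₃ , _) close =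
      v₀≢v₂ (oneBoth l₀ l₂ (between c₁ c₃ v₁≢v₃ (EdgeIn-sym e₀₁) (EdgeIn-sym close))
                           (between c₁ c₃ v₁≢v₃ e₁₂ e₂₃))
      where c₃ = adj-leaf (edge-adj inG e₂₃) l₂
    centreSecond (v₃ ∷ v₄ ∷ []) _ (e₂₃ , e₃₄ , _) close =
      centre-not-leaf (adj-leaf (edge-adj inG close) l₄) l₀
      where l₄ = adj-centre (edge-adj inG e₃₄) (adj-leaf (edge-adj inG e₂₃) l₂)
    centreSecond (v₃ ∷ v₄ ∷ v₅ ∷ _) (_ ∷ (_ ∷ v₁≢v₃ ∷ _ ∷ v₁≢v₅ ∷ _) ∷ _ ∷ (_ ∷ v₃≢v₅ ∷ _) ∷ _)
                 (e₂₃ , e₃₄ , e₄₅ , _) _ =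
      no-three-centres c₁ c₃ c₅ v₁≢v₃ v₃≢v₅ v₁≢v₅
      where
      c₃ = adj-leaf (edge-adj inG e₂₃) l₂
      c₅ = adj-leaf (edge-adj inG e₄₅) (adj-centre (edge-adj inG e₃₄) c₃)
  ... | no ¬c₁ = leafSecond vs vs! path close
    where
    -- v₁ is a leaf, so v₀, v₂, v₄, … are centres: length 3 joins two centres,
    -- length 4 gives two leaves v₁ ≠ v₃ joined to both centres, and a longer
    -- cycle contains three different centres v₀, v₂, v₄.
    l₁ = ≮⇒≥ ¬c₁
    c₀ = adj-leaf (Graph.sym (K2 t) (edge-adj inG e₀₁)) l₁
    c₂ = adj-leaf (edge-adj inG e₁₂) l₁
    leafSecond : ∀ vs → Unique (v₀ ∷ v₁ ∷ v₂ ∷ vs) → Consecutive E (v₂ ∷ vs) →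
                 EdgeIn E (last? v₂ vs) v₀ → ⊥
    leafSecond [] _ _ close = centre-not-leaf c₀ (adj-centre (edge-adj inG close) c₂)
    leafSecond (v₃ ∷ []) ((_ ∷ v₀≢v₂ ∷ _) ∷ (_ ∷ v₁≢v₃ ∷ []) ∷ _) (e₂₃ , _) close =
      v₁≢v₃ (oneBoth l₁ l₃ (between c₀ c₂ v₀≢v₂ e₀₁ e₁₂)
                           (between c₂ c₀ (λ e → v₀≢v₂ (≡.sym e)) e₂₃ close))
      where l₃ = adj-centre (edge-adj inG e₂₃) c₂
    leafSecond (v₃ ∷ v₄ ∷ _) ((_ ∷ v₀≢v₂ ∷ _ ∷ v₀≢v₄ ∷ _) ∷ _ ∷ (_ ∷ v₂≢v₄ ∷ _) ∷ _) (e₂₃ , e₃₄ , _) _ =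
      no-three-centres c₀ c₂ c₄ v₀≢v₂ v₂≢v₄ v₀≢v₄
      where c₄ = adj-leaf (edge-adj inG e₃₄) (adj-centre (edge-adj inG e₂₃) c₂)

-- The pair of colours a leaf receives from the two centres.
Profile : Set
Profile = ℕ × ℕ

pick : Profile → Bool → ℕ
pick (x , _) false = x
pick (_ , y) true  = y

∨-introˡ : ∀ {a} b → T a → T (a ∨ b)
∨-introˡ _ ta = Equivalence.from T-∨ (inj₁ ta)

∨-introʳ : ∀ a {b} → T b → T (a ∨ b)
∨-introʳ _ tb = Equivalence.from T-∨ (inj₂ tb)

someSide : (Bool → Bool) → Bool
someSide f = f false ∨ f true

someSide-intro : ∀ f s → T (f s) → T (someSide f)
someSide-intro f false = ∨-introˡ (f true)
someSide-intro f true  = ∨-introʳ (f false)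

-- Boolean tests on the profiles u, v, w of three leaves, one for each way in
-- which a rainbow tree can reach them (a side s : Bool names a centre):
-- legsApart: the leaves hang on the centres s₁, s₂, s₃ with three colours;
legsApart : Bool → Bool → Bool → Profile → Profile → Profile → Bool
legsApart s₁ s₂ s₃ u v w = distinct (pick u s₁ ∷ pick v s₂ ∷ pick w s₃ ∷ [])

-- hubFirst: the first leaf is joined to both centres, the other two hang on
-- s₁ and s₂, and the four colours differ.
hubFirst : Bool → Bool → Profile → Profile → Profile → Bool
hubFirst s₁ s₂ u v w = distinct (pick u false ∷ pick u true ∷ pick v s₁ ∷ pick w s₂ ∷ [])

oneCentre : Profile → Profile → Profile → Bool
oneCentre u v w = someSide λ s → legsApart s s s u v w

throughLeaf : Profile → Profile → Profile → Bool
throughLeaf u v w = someSide λ s₁ → someSide λ s₂ → hubFirst s₁ s₂ u v w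

-- a path between the centres through a fourth leaf
apartLegs : Profile → Profile → Profile → Bool
apartLegs u v w = someSide λ s₁ → someSide λ s₂ → someSide λ s₃ → legsApart s₁ s₂ s₃ u v w

oneCentre-intro : ∀ s {u v w} → T (legsApart s s s u v w) → T (oneCentre u v w)
oneCentre-intro s {u} {v} {w} = someSide-intro (λ s → legsApart s s s u v w) s

throughLeaf-intro : ∀ s₁ s₂ {u v w} → T (hubFirst s₁ s₂ u v w) → T (throughLeaf u v w)
throughLeaf-intro s₁ s₂ {u} {v} {w} =
  someSide-intro (λ s₁ → someSide λ s₂ → hubFirst s₁ s₂ u v w) s₁ ∘
  someSide-intro (λ s₂ → hubFirst s₁ s₂ u v w) s₂

apartLegs-intro : ∀ s₁ s₂ s₃ {u v w} → T (legsApart s₁ s₂ s₃ u v w) → T (apartLegs u v w)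
apartLegs-intro s₁ s₂ s₃ {u} {v} {w} =
  someSide-intro (λ s₁ → someSide λ s₂ → someSide λ s₃ → legsApart s₁ s₂ s₃ u v w) s₁ ∘
  someSide-intro (λ s₂ → someSide λ s₃ → legsApart s₁ s₂ s₃ u v w) s₂ ∘
  someSide-intro (λ s₃ → legsApart s₁ s₂ s₃ u v w) s₃

-- the shapes without a fourth leaf (possible with four colours) ...
compatible₄ : Profile → Profile → Profile → Bool
compatible₄ u v w = oneCentre u v w ∨ throughLeaf u v w ∨ throughLeaf v u w ∨ throughLeaf w u v

-- ... and all shapes (possible with five colours)
compatible₅ : Profile → Profile → Profile → Bool
compatible₅ u v w = compatible₄ u v w ∨ apartLegs u v w

-- The ways a rainbow tree can reach three leaves with profiles u, v, w:
-- a star at one centre, a path through one of the three leaves, or a path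
-- through a fourth leaf, which uses five edges and so needs five colours.
data Shape (j : ℕ) (u v w : Profile) : Set where
  star    : T (oneCentre u v w)   → Shape j u v w
  hub₁    : T (throughLeaf u v w) → Shape j u v w
  hub₂    : T (throughLeaf v u w) → Shape j u v w
  hub₃    : T (throughLeaf w u v) → Shape j u v w
  outside : 5 ≤ j → T (apartLegs u v w) → Shape j u v w

module Necessary {t j : ℕ} (c : Colouring (K2 t) j) where
  open K2 t
  open import Data.List.Membership.DecPropositional (_≟ᶠ_ {2 + t}) using (_∈?_)

  profile : Vertex → Profile
  profile v = toℕ (col c (cen false) v) , toℕ (col c (cen true) v)

  -- a leg (v , s) is the edge from leaf v to centre cen s
  legColour : Vertex × Bool → Fin j
  legColour (v , s) = col c (cen s) v

  legValue : Vertex × Bool → ℕ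
  legValue (v , s) = pick (profile v) s

  legValue-colour : ∀ l → legValue l ≡ toℕ (legColour l)
  legValue-colour (v , false) = refl
  legValue-colour (v , true)  = refl


  module InTree {V E} (tree : IsTree (K2 t) V E) (rainbow : Rainbow c E) where
    open IsTree tree

    IsLeg : Vertex × Bool → Set
    IsLeg (v , s) = IsLeaf v × EdgeIn E v (cen s)

    edgeColour : Ed → Fin j
    edgeColour (u , v) = col c u v

    rainbow-∈ : ∀ {e e'} → e ∈ E → e' ∈ E → e ≢ e' → edgeColour e ≢ edgeColour e'
    rainbow-∈ = go rainbow
      where
      go : ∀ {E} → Rainbow c E → ∀ {e e'} → e ∈ E → e' ∈ E → e ≢ e' → edgeColour e ≢ edgeColour e'
      go (_  ∷ _) (here refl) (here refl) e≢e' = ⊥-elim (e≢e' refl)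
      go (e∉ ∷ _) (here refl) (there e'∈) _    = All.lookup e∉ e'∈
      go (e∉ ∷ _) (there e∈) (here refl)  _    = λ eq → All.lookup e∉ e∈ (≡.sym eq)
      go (_ ∷ E!) (there e∈) (there e'∈)  e≢e' = go E! e∈ e'∈ e≢e'

    leg-colours-differ : ∀ {l l'} → IsLeg l → IsLeg l' → l ≢ l' → legColour l ≢ legColour l'
    leg-colours-differ {v , s} {v' , s'} (lv , e) (lv' , e') l≢l' = entries e e'
      where
      same : v ≡ v' → cen s ≡ cen s' → ⊥
      same refl eq with cen-injective eq
      ... | refl = l≢l' refl
      leaf≢centre : ∀ {x s″} → IsLeaf x → x ≢ cen s″
      leaf≢centre {s″ = s″} lx refl = centre-not-leaf (cen-isCentre s″) lx
      entries : EdgeIn E v (cen s) → EdgeIn E v' (cen s') → legColour (v , s) ≢ legColour (v' , s')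
      entries (inj₁ m) (inj₁ m') eq = rainbow-∈ m m' (λ e → same (cong proj₁ e) (cong proj₂ e))
        (trans (colSym c v (cen s)) (trans eq (colSym c (cen s') v')))
      entries (inj₁ m) (inj₂ m') eq = rainbow-∈ m m' (λ e → leaf≢centre lv (cong proj₁ e))
        (trans (colSym c v (cen s)) eq)
      entries (inj₂ m) (inj₁ m') eq = rainbow-∈ m m' (λ e → leaf≢centre lv' (≡.sym (cong proj₁ e)))
        (trans eq (colSym c (cen s') v'))
      entries (inj₂ m) (inj₂ m') eq = rainbow-∈ m m' (λ e → same (cong proj₂ e) (cong proj₁ e)) eq

    leg-colours-apart : ∀ {ls} → All IsLeg ls → AllPairs _≢_ ls →
                        AllPairs (λ l l' → legColour l ≢ legColour l') ls
    leg-colours-apart []           []           = []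
    leg-colours-apart (leg ∷ legs) (l∉ ∷ ls!) =
      All.zipWith (λ (leg' , l≢l') → leg-colours-differ leg leg' l≢l') (legs , l∉)
        ∷ leg-colours-apart legs ls!

    legs-apart : ∀ {ls} → All IsLeg ls → AllPairs _≢_ ls → T (distinct (map legValue ls))
    legs-apart legs ls! =
      distinct-complete (AllPairsₚ.map⁺ (AllPairs.map differ (leg-colours-apart legs ls!)))
      where
      differ : ∀ {l l'} → legColour l ≢ legColour l' → legValue l ≢ legValue l'
      differ {l} {l'} ne eq =
        ne (toℕ-injective (trans (≡.sym (legValue-colour l)) (trans eq (legValue-colour l'))))

    legs-count : ∀ {ls} → All IsLeg ls → AllPairs _≢_ ls → length ls ≤ j
    legs-count {ls} legs ls! =
      subst (_≤ j) (length-map legColour ls)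
        (distinct⇒length≤ (AllPairsₚ.map⁺ (leg-colours-apart legs ls!)))

    endpoint-∈ : ∀ {u v} → EdgeIn E u v → v ∈ V
    endpoint-∈ (inj₁ uv) = proj₂ (All.lookup endpoints uv)
    endpoint-∈ (inj₂ vu) = proj₁ (All.lookup endpoints vu)

    attach : ∀ {v w} → v ∈ V → w ∈ V → v ≢ w → IsLeaf v → Σ Bool λ s → IsLeg (v , s)
    attach v∈ w∈ v≢w lv with connected v∈ w∈
    ... | here = ⊥-elim (v≢w refl)
    ... | step e _ with centre-cen (adj-leaf (edge-adj edgesOfG e) lv)
    ...   | s , refl = s , lv , e

    other-centre : ∀ {m v s} → cen m ∉ V → IsLeg (v , s) → IsLeg (v , not m)
    other-centre {false} {s = false} A∉ (_ , e) = ⊥-elim (A∉ (endpoint-∈ e))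
    other-centre {false} {s = true}  _  leg     = leg
    other-centre {true}  {s = false} _  leg     = leg
    other-centre {true}  {s = true}  B∉ (_ , e) = ⊥-elim (B∉ (endpoint-∈ e))

    hub : cen false ∈ V → cen true ∈ V →
          Σ Vertex λ w → IsLeaf w × EdgeIn E (cen false) w × EdgeIn E w (cen true)
    hub A∈ B∈ = fromA (connected A∈ B∈)
      where
      fromA : Walk E (cen false) (cen true) →
              Σ Vertex λ w → IsLeaf w × EdgeIn E (cen false) w × EdgeIn E w (cen true)
      fromA (step e here) = ⊥-elim
        (centre-not-leaf (cen-isCentre true) (adj-centre (edge-adj edgesOfG e) (cen-isCentre false)))
      fromA (step {w = w} e₁ (step e₂ rest))
        with lw ← adj-centre (edge-adj edgesOfG e₁) (cen-isCentre false)
        with centre-cen (adj-leaf (edge-adj edgesOfG e₂) lw)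
      ... | false , refl = fromA rest
      ... | true  , refl = w , lw , e₁ , e₂

    apart : ∀ {x y : Vertex} {s s' : Bool} → x ≢ y → (x , s) ≢ (y , s')
    apart x≢y = x≢y ∘ cong proj₁

    apart₃ : ∀ {x y z : Vertex} {s₁ s₂ s₃ : Bool} → x ≢ y → y ≢ z → x ≢ z →
             AllPairs _≢_ ((x , s₁) ∷ (y , s₂) ∷ (z , s₃) ∷ [])
    apart₃ x≢y y≢z x≢z = (apart x≢y ∷ apart x≢z ∷ []) ∷ (apart y≢z ∷ []) ∷ [] ∷ []

    hubLegs : ∀ {x y z : Vertex} {sy sz} → x ≢ y → x ≢ z → y ≢ z →
              AllPairs _≢_ ((x , false) ∷ (x , true) ∷ (y , sy) ∷ (z , sz) ∷ [])
    hubLegs x≢y x≢z y≢z = ((λ ()) ∷ apart x≢y ∷ apart x≢z ∷ []) ∷ apart₃ x≢y y≢z x≢z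

    oneCentre-star : ∀ {m x y z sx sy sz} → cen m ∉ V →
                     IsLeg (x , sx) → IsLeg (y , sy) → IsLeg (z , sz) →
                     x ≢ y → y ≢ z → x ≢ z → T (oneCentre (profile x) (profile y) (profile z))
    oneCentre-star {m} {x} {y} {z} m∉ legx legy legz x≢y y≢z x≢z =
      oneCentre-intro (not m) {profile x} {profile y} {profile z}
        (legs-apart (other-centre m∉ legx ∷ other-centre m∉ legy ∷ other-centre m∉ legz ∷ [])
                    (apart₃ x≢y y≢z x≢z))

    viaHub : ∀ {x y z sy sz} → IsLeaf x → EdgeIn E (cen false) x → EdgeIn E x (cen true) →
             IsLeg (y , sy) → IsLeg (z , sz) → x ≢ y → x ≢ z → y ≢ z →
             T (throughLeaf (profile x) (profile y) (profile z))
    viaHub {x} {y} {z} {sy} {sz} lx Ax xB legy legz x≢y x≢z y≢z =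
      throughLeaf-intro sy sz {profile x} {profile y} {profile z}
        (legs-apart ((lx , EdgeIn-sym Ax) ∷ (lx , xB) ∷ legy ∷ legz ∷ []) (hubLegs x≢y x≢z y≢z))

    -- Case analysis on the shape of the tree: a missing centre gives a star;
    -- otherwise the path between the centres has a hub leaf, which is one of
    -- p, q, r or a fourth leaf (then five edges need five colours).
    leaves-shape : ∀ {p q r} → p ∈ V → q ∈ V → r ∈ V → IsLeaf p → IsLeaf q → IsLeaf r →
                   p ≢ q → q ≢ r → p ≢ r → Shape j (profile p) (profile q) (profile r)
    leaves-shape {p} {q} {r} p∈ q∈ r∈ lp lq lr p≢q q≢r p≢r
      with sp , legp ← attach p∈ q∈ p≢q lp
      with sq , legq ← attach q∈ r∈ q≢r lq
      with sr , legr ← attach r∈ p∈ (p≢r ∘ ≡.sym) lr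
      with cen false ∈? V | cen true ∈? V
    ... | no A∉  | _      = star (oneCentre-star A∉ legp legq legr p≢q q≢r p≢r)
    ... | yes _  | no B∉  = star (oneCentre-star B∉ legp legq legr p≢q q≢r p≢r)
    ... | yes A∈ | yes B∈ with hub A∈ B∈
    ... | w , lw , Aw , wB with w ≟ᶠ p | w ≟ᶠ q | w ≟ᶠ r
    ... | yes refl | _        | _        =
      hub₁ (viaHub lw Aw wB legq legr p≢q p≢r q≢r)
    ... | no _     | yes refl | _        =
      hub₂ (viaHub lw Aw wB legp legr (p≢q ∘ ≡.sym) q≢r p≢r)
    ... | no _     | no _     | yes refl =
      hub₃ (viaHub lw Aw wB legp legq (p≢r ∘ ≡.sym) (q≢r ∘ ≡.sym) p≢q)
    ... | no w≢p   | no w≢q   | no w≢r   =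
      outside (legs-count ((lw , EdgeIn-sym Aw) ∷ (lw , wB) ∷ legp ∷ legq ∷ legr ∷ [])
                          (((λ ()) ∷ apart w≢p ∷ apart w≢q ∷ apart w≢r ∷ []) ∷
                           (apart w≢p ∷ apart w≢q ∷ apart w≢r ∷ []) ∷ apart₃ p≢q q≢r p≢r))
              (apartLegs-intro sp sq sr {profile p} {profile q} {profile r}
                 (legs-apart (legp ∷ legq ∷ legr ∷ []) (apart₃ p≢q q≢r p≢r)))

  rainbow⇒shape : Is3Rainbow (K2 t) c → ∀ {p q r} → IsLeaf p → IsLeaf q → IsLeaf r →
                  p ≢ q → q ≢ r → p ≢ r → Shape j (profile p) (profile q) (profile r)
  rainbow⇒shape is3 {p} {q} {r} lp lq lr p≢q q≢r p≢r
    with V , E , tree , p∈ , q∈ , r∈ , rainbow ← is3 p q r p≢q q≢r p≢r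
    = InTree.leaves-shape tree rainbow p∈ q∈ r∈ lp lq lr p≢q q≢r p≢r

InRange : ℕ → Profile → Set
InRange K (x , y) = x < K × y < K

record Separation (K m : ℕ) (allowed : Profile → Profile → Profile → Bool) : Set where
  field
    class     : Profile → ℕ
    bounded   : ∀ {u} → InRange K u → class u < m
    separates : ∀ {u v w} → InRange K u → InRange K v → InRange K w →
                class u ≡ class v → class v ≡ class w → ¬ T (allowed u v w)

isSeparation : (K m : ℕ) → (Profile → ℕ) → (Profile → Profile → Profile → Bool) → Bool
isSeparation K m class allowed =
  all (λ u → class u <ᵇ m) profiles ∧
  all (λ u → all (λ v → all (λ w → separated u v w) profiles) profiles) profiles
  where
  profiles = cartesianProduct (upTo K) (upTo K)
  separated : Profile → Profile → Profile → Bool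
  separated u v w = not ((class u ≡ᵇ class v) ∧ (class v ≡ᵇ class w)) ∨ not (allowed u v w)

separation : ∀ K m class allowed → T (isSeparation K m class allowed) → Separation K m allowed
separation K m class allowed ok = record
  { class     = class
  ; bounded   = λ {u} u<K → <ᵇ⇒< (class u) m (All.lookup (all⁺ _ _ boundedOk) (inRange u<K))
  ; separates = λ u<K v<K w<K uv vw → separated (at (at (at separatedOk u<K) v<K) w<K) uv vw
  }
  where
  profiles = cartesianProduct (upTo K) (upTo K)
  boundedOk = proj₁ (Equivalence.to T-∧ ok)
  separatedOk = proj₂ (Equivalence.to T-∧ ok)

  inRange : ∀ {u} → InRange K u → u ∈ profiles
  inRange (x<K , y<K) = ∈-cartesianProduct⁺ (∈-upTo⁺ x<K) (∈-upTo⁺ y<K)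

  at : ∀ {f : Profile → Bool} {u} → T (all f profiles) → InRange K u → T (f u)
  at {f} allOk u<K = All.lookup (all⁺ f profiles allOk) (inRange u<K)

  separated : ∀ {u v w} → T (not ((class u ≡ᵇ class v) ∧ (class v ≡ᵇ class w)) ∨ not (allowed u v w)) →
              class u ≡ class v → class v ≡ class w → ¬ T (allowed u v w)
  separated {u} {v} {w} sep uv vw ok-uvw with Equivalence.to T-∨ sep
  ... | inj₁ differ = not-T differ (Equivalence.from T-∧ (≡⇒≡ᵇ _ _ uv , ≡⇒≡ᵇ _ _ vw))
  ... | inj₂ forbid = not-T forbid ok-uvw

shape⇒compatible : ∀ {j u v w} → Shape j u v w → T (compatible₄ u v w) ⊎ (5 ≤ j × T (apartLegs u v w))
shape⇒compatible {u = u} {v} {w} (star ok) =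
  inj₁ (∨-introˡ (throughLeaf u v w ∨ throughLeaf v u w ∨ throughLeaf w u v) ok)
shape⇒compatible {u = u} {v} {w} (hub₁ ok) =
  inj₁ (∨-introʳ (oneCentre u v w) (∨-introˡ (throughLeaf v u w ∨ throughLeaf w u v) ok))
shape⇒compatible {u = u} {v} {w} (hub₂ ok) =
  inj₁ (∨-introʳ (oneCentre u v w) (∨-introʳ (throughLeaf u v w) (∨-introˡ (throughLeaf w u v) ok)))
shape⇒compatible {u = u} {v} {w} (hub₃ ok) =
  inj₁ (∨-introʳ (oneCentre u v w) (∨-introʳ (throughLeaf u v w) (∨-introʳ (throughLeaf v u w) ok)))
shape⇒compatible (outside 5≤j ok) = inj₂ (5≤j , ok)

-- Pigeonhole argument: with more than 2m leaves, three leaves share a class,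
-- but the tree that a 3-rainbow colouring provides for them realises a
-- shape that the separation excludes.
no-rainbow-colouring : ∀ {t j K m allowed} → Separation K m allowed → j ≤ K → m + m < t →
                       (∀ {u v w} → Shape j u v w → T (allowed u v w)) →
                       (c : Colouring (K2 t) j) → ¬ Is3Rainbow (K2 t) c
no-rainbow-colouring {t} {j} {K} {m} sep j≤K long shape⇒allowed c is3 =
  excluded (pigeonhole₃ classOf m (allFin t) (allFin⁺ t) (All.tabulate λ {a} _ → bounded (inRange (leaf a)))
                        (subst (m + m <_) (≡.sym (length-tabulate (λ a → a))) long))
  where
  open K2 t
  open Necessary c
  open Separation sep

  inRange : ∀ v → InRange K (profile v)
  inRange v = ≤-trans (toℕ<n (col c (cen false) v)) j≤K , ≤-trans (toℕ<n (col c (cen true) v)) j≤K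

  classOf : Fin t → ℕ
  classOf a = class (profile (leaf a))

  excluded : Triple classOf (allFin t) → ⊥
  excluded (triple {a} {b} {d} _ (a≢b , b≢d , a≢d) (ab , bd)) =
    separates (inRange (leaf a)) (inRange (leaf b)) (inRange (leaf d)) ab bd
      (shape⇒allowed (rainbow⇒shape is3 (leaf-isLeaf a) (leaf-isLeaf b) (leaf-isLeaf d)
        (a≢b ∘ leaf-injective) (b≢d ∘ leaf-injective) (a≢d ∘ leaf-injective)))

separation₄ : Separation 4 4 compatible₄
separation₄ = separation 4 4 (λ (x , y) → x % 2 * 2 + y / 2) compatible₄ _

class₅ : Profile → ℕ
class₅ (x , y) with (y + 5 ∸ x) % 5
... | 2 = 5 + x
... | 3 = 5 + y
... | 4 = y
... | _ = x

separation₅ : Separation 5 10 compatible₅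
separation₅ = separation 5 10 class₅ compatible₅ _

fewer-than-five : ∀ {t j} → 9 ≤ t → j < 5 → ¬ Has3RainbowColouring (K2 t) j
fewer-than-five 9≤t j<5 (c , is3) =
  no-rainbow-colouring separation₄ (≤-pred j<5) 9≤t only₄ c is3
  where
  only₄ : ∀ {u v w} → Shape _ u v w → T (compatible₄ u v w)
  only₄ shape with shape⇒compatible shape
  ... | inj₁ ok         = ok
  ... | inj₂ (5≤j , _) = ⊥-elim (<⇒≱ j<5 5≤j)

fewer-than-six : ∀ {t} → 21 ≤ t → Rx3≥ (K2 t) 6
fewer-than-six 21≤t j (c , is3) with 6 ≤? j
... | yes 6≤j = 6≤j
... | no  6≰j = ⊥-elim (no-rainbow-colouring separation₅ (≤-pred (≰⇒> 6≰j)) 21≤t with₅ c is3)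
  where
  with₅ : ∀ {u v w} → Shape _ u v w → T (compatible₅ u v w)
  with₅ {u} {v} {w} shape with shape⇒compatible shape
  ... | inj₁ ok       = ∨-introˡ (apartLegs u v w) ok
  ... | inj₂ (_ , ok) = ∨-introʳ (compatible₄ u v w) ok

-- Rainbow trees of K_{2,t} used for the upper bound: stars at a centre and
-- spiders, in which a hub leaf is joined to both centres and every other leaf
-- hangs on one of them.
module Trees (t : ℕ) where
  open K2 t

  Leg : Set
  Leg = Fin t × Bool

  legEdge : Leg → Ed
  legEdge (a , s) = cen s , leaf a

  legEdges : List Leg → List Ed
  legEdges = map legEdge

  legLeaves : List Leg → List Vertex
  legLeaves = map (leaf ∘ proj₁)

  legEdge-injective : ∀ {l l'} → SameEdge (legEdge l) (legEdge l') → l ≡ l'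
  legEdge-injective {a , s} {a' , s'} (inj₁ (cs≡cs' , refl)) with cen-injective cs≡cs'
  ... | refl = refl
  legEdge-injective {a , s} {a' , s'} (inj₂ (cs≡la' , _)) = ⊥-elim (cen≢leaf s a' cs≡la')

  legEdges-distinct : ∀ {ls} → AllPairs _≢_ ls → AllPairs (λ e f → ¬ SameEdge e f) (legEdges ls)
  legEdges-distinct = AllPairsₚ.map⁺ ∘ AllPairs.map (λ l≢l' → l≢l' ∘ legEdge-injective)

  legEdges-inG : ∀ ls → InG (legEdges ls)
  legEdges-inG ls = Allₚ.map⁺ (All.tabulate λ { {a , s} _ → inj₁ (cen-isCentre s , leaf-isLeaf a) })

  legEdges-endpoints : ∀ {V} ls → (∀ {a s} → (a , s) ∈ ls → cen s ∈ V) →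
                       (∀ {a s} → (a , s) ∈ ls → leaf a ∈ V) →
                       All (λ e → proj₁ e ∈ V × proj₂ e ∈ V) (legEdges ls)
  legEdges-endpoints ls cen∈ leaf∈ = Allₚ.map⁺ (All.tabulate λ { {a , s} l∈ → cen∈ l∈ , leaf∈ l∈ })

  leg-edgeIn : ∀ {ls a s} → (a , s) ∈ ls → EdgeIn (legEdges ls) (leaf a) (cen s)
  leg-edgeIn l∈ = inj₂ (∈-map⁺ legEdge l∈)

  edgeIn-leg : ∀ {ls u s} → IsLeaf u → EdgeIn (legEdges ls) u (cen s) →
               ∃ λ a → (a , s) ∈ ls × u ≡ leaf a
  edgeIn-leg lu (inj₁ m) with ∈-map⁻ legEdge m
  ... | (_ , s') , _ , eq = ⊥-elim (centre-not-leaf (subst IsCentre (≡.sym (cong proj₁ eq)) (cen-isCentre s')) lu)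
  edgeIn-leg lu (inj₂ m) with ∈-map⁻ legEdge m
  ... | (a , s') , l∈ , eq with cen-injective (cong proj₁ eq)
  ...   | refl = a , l∈ , cong proj₂ eq

  leaves-walk : ∀ {ls E root} → (∀ {a s} → (a , s) ∈ ls → Walk E (leaf a) root) →
                ∀ {v} → v ∈ legLeaves ls → Walk E v root
  leaves-walk walk v∈ with ∈-map⁻ (leaf ∘ proj₁) v∈
  ... | (a , s) , l∈ , refl = walk l∈

  unique-legs : ∀ {ls} → Unique (legLeaves ls) → AllPairs _≢_ ls
  unique-legs = AllPairs.map (λ ne eq → ne (cong (leaf ∘ proj₁) eq)) ∘ AllPairsₚ.map⁻

  centre∉legLeaves : ∀ s ls → All (cen s ≢_) (legLeaves ls)
  centre∉legLeaves s ls = Allₚ.map⁺ (All.tabulate λ {l} _ → cen≢leaf s (proj₁ l))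

  starTree : ∀ s ls → All (λ l → proj₂ l ≡ s) ls → Unique (legLeaves ls) →
             IsTree (K2 t) (cen s ∷ legLeaves ls) (legEdges ls)
  starTree s ls atS leaves! = record
    { nonempty  = s≤s z≤n
    ; vDistinct = centre∉legLeaves s ls ∷ leaves!
    ; eDistinct = legEdges-distinct (unique-legs leaves!)
    ; edgesOfG  = legEdges-inG ls
    ; endpoints = legEdges-endpoints ls (λ l∈ → here (cong cen (All.lookup atS l∈)))
                                        (λ l∈ → there (∈-map⁺ (leaf ∘ proj₁) l∈))
    ; connected = via-root toCentre
    ; acyclic   = acyclic (legEdges-inG ls)
                    λ lu _ (uA , uB) _ → ⊥-elim (sides-differ (edgeIn-leg lu uA) (edgeIn-leg lu uB))
    }
    where
    toCentre : ∀ {v} → v ∈ cen s ∷ legLeaves ls → Walk (legEdges ls) v (cen s)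
    toCentre (here refl) = here
    toCentre (there v∈)  =
      leaves-walk (λ l∈ → step (subst (λ x → EdgeIn _ _ (cen x)) (All.lookup atS l∈) (leg-edgeIn l∈)) here) v∈

    -- all legs end at s, so no leaf meets both centres
    sides-differ : ∀ {u} → ∃ (λ a → (a , false) ∈ ls × u ≡ leaf a) →
                   ∃ (λ a → (a , true) ∈ ls × u ≡ leaf a) → ⊥
    sides-differ (_ , f∈ , _) (_ , t∈ , _) with trans (All.lookup atS f∈) (≡.sym (All.lookup atS t∈))
    ... | ()

  spiderLegs : Fin t → List Leg → List Leg
  spiderLegs w ls = (w , false) ∷ (w , true) ∷ ls

  spiderTree : ∀ w ls → Unique (leaf w ∷ legLeaves ls) →
               IsTree (K2 t) (cen false ∷ cen true ∷ leaf w ∷ legLeaves ls) (legEdges (spiderLegs w ls))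
  spiderTree w ls (w∉ ∷ leaves!) = record
    { nonempty  = s≤s z≤n
    ; vDistinct = ((λ ()) ∷ centre∉legLeaves false ((w , false) ∷ ls))
                  ∷ centre∉legLeaves true ((w , false) ∷ ls) ∷ w∉ ∷ leaves!
    ; eDistinct = legEdges-distinct legs!
    ; edgesOfG  = legEdges-inG (spiderLegs w ls)
    ; endpoints = legEdges-endpoints (spiderLegs w ls) (λ {_} {s} _ → centre∈ s) leaf∈
    ; connected = via-root toA
    ; acyclic   = acyclic (legEdges-inG (spiderLegs w ls))
                    λ lu lv bu bv → trans (hub-only lu bu) (≡.sym (hub-only lv bv))
    }
    where
    E = legEdges (spiderLegs w ls)
    V = cen false ∷ cen true ∷ leaf w ∷ legLeaves ls

    hub≢legs : ∀ {s} → All ((w , s) ≢_) ls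
    hub≢legs = All.map (λ ne eq → ne (cong (leaf ∘ proj₁) eq)) (Allₚ.map⁻ w∉)

    legs! : AllPairs _≢_ (spiderLegs w ls)
    legs! = ((λ ()) ∷ hub≢legs) ∷ hub≢legs ∷ unique-legs leaves!

    centre∈ : ∀ s → cen s ∈ V
    centre∈ false = here refl
    centre∈ true  = there (here refl)

    leaf∈ : ∀ {a s} → (a , s) ∈ spiderLegs w ls → leaf a ∈ V
    leaf∈ (here refl)         = there (there (here refl))
    leaf∈ (there (here refl)) = there (there (here refl))
    leaf∈ (there (there l∈))  = there (there (there (∈-map⁺ (leaf ∘ proj₁) l∈)))

    hubToA : Walk E (leaf w) (cen false)
    hubToA = step (leg-edgeIn (here refl)) here

    centreToA : ∀ s → Walk E (cen s) (cen false)
    centreToA false = here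
    centreToA true  = step (EdgeIn-sym (leg-edgeIn (there (here refl)))) hubToA

    toA : ∀ {v} → v ∈ V → Walk E v (cen false)
    toA (here refl)                 = here
    toA (there (here refl))         = centreToA true
    toA (there (there (here refl))) = hubToA
    toA (there (there (there v∈)))  =
      leaves-walk (λ {_} {s} l∈ → step (leg-edgeIn (there (there l∈))) (centreToA s)) v∈

    -- only the hub meets both centres: two legs at one leaf lie at the hub
    hub-only : ∀ {u} → IsLeaf u → Both E u → u ≡ leaf w
    hub-only lu (uA , uB) with edgeIn-leg lu uA | edgeIn-leg lu uB
    ... | _ , here refl , u≡       | _                        = u≡
    ... | _ , there (here ()) , _  | _
    ... | _                        | _ , here () , _
    ... | _                        | _ , there (here refl) , u≡ = u≡
    ... | _ , there (there f∈) , refl | _ , there (there t∈) , u≡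
      with unique-map leaves! f∈ t∈ u≡
    ...   | ()

leafColours : ℕ → Fin 5 × Fin 5
leafColours 0  = # 4 , # 1
leafColours 1  = # 2 , # 4
leafColours 2  = # 3 , # 4
leafColours 3  = # 3 , # 2
leafColours 4  = # 1 , # 3
leafColours 5  = # 4 , # 0
leafColours 6  = # 0 , # 1
leafColours 7  = # 1 , # 2
leafColours 8  = # 2 , # 0
leafColours 9  = # 0 , # 3
leafColours 10 = # 1 , # 4
leafColours 11 = # 4 , # 2
leafColours 12 = # 4 , # 3
leafColours 13 = # 2 , # 3
leafColours 14 = # 3 , # 1
leafColours 15 = # 0 , # 4
leafColours 16 = # 1 , # 0
leafColours 17 = # 2 , # 1
leafColours 18 = # 0 , # 2
leafColours 19 = # 3 , # 0
leafColours _  = # 0 , # 0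

leafProfile : ℕ → Profile
leafProfile i = toℕ (proj₁ (leafColours i)) , toℕ (proj₂ (leafColours i))

-- A certificate names the shape of a rainbow tree through leaves i, j, l:
-- a star, a hub among the three (the first, second or third), or a hub w
-- outside them with the sides of the three legs.
data Certificate : Set where
  viaStar                     : Bool → Certificate
  viaFirst viaSecond viaThird : Bool → Bool → Certificate
  viaOutside                  : ℕ → Bool → Bool → Bool → Certificate

hubOutside : ℕ → Bool → Bool → Bool → Profile → Profile → Profile → Bool
hubOutside w s₁ s₂ s₃ u v x = distinct (pick (leafProfile w) false ∷ pick (leafProfile w) true ∷
                                        pick u s₁ ∷ pick v s₂ ∷ pick x s₃ ∷ [])

-- the hub is a genuine leaf whenever t ≥ 9: either w < 9, or w ≤ one of i, j, l
hubInRange : ℕ → ℕ → ℕ → ℕ → Bool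
hubInRange w i j l = (w <ᵇ 9) ∨ (w ≤ᵇ i ⊔ j ⊔ l)

valid : ℕ → ℕ → ℕ → Certificate → Bool
valid i j l (viaStar s)       = legsApart s s s (leafProfile i) (leafProfile j) (leafProfile l)
valid i j l (viaFirst s₁ s₂)  = hubFirst s₁ s₂ (leafProfile i) (leafProfile j) (leafProfile l)
valid i j l (viaSecond s₁ s₂) = hubFirst s₁ s₂ (leafProfile j) (leafProfile i) (leafProfile l)
valid i j l (viaThird s₁ s₂)  = hubFirst s₁ s₂ (leafProfile l) (leafProfile i) (leafProfile j)
valid i j l (viaOutside w s₁ s₂ s₃) =
  distinct (w ∷ i ∷ j ∷ l ∷ []) ∧ hubInRange w i j l ∧
  hubOutside w s₁ s₂ s₃ (leafProfile i) (leafProfile j) (leafProfile l)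

sides : List Bool
sides = false ∷ true ∷ []

side∈ : ∀ s → s ∈ sides
side∈ false = here refl
side∈ true  = there (here refl)

candidates : List Certificate
candidates =
  map viaStar sides ++
  concatMap (λ s₁ → concatMap (λ s₂ → viaFirst s₁ s₂ ∷ viaSecond s₁ s₂ ∷ viaThird s₁ s₂ ∷ []) sides) sides ++
  concatMap (λ w → concatMap (λ s₁ → concatMap (λ s₂ → map (viaOutside w s₁ s₂) sides) sides) sides) (upTo 10)

-- Checks for the three kinds of vertex triples containing leaves:
-- both centres and a leaf i (the spider with hub i) ...
hubOK : ℕ → Bool
hubOK i = distinct (pick (leafProfile i) false ∷ pick (leafProfile i) true ∷ [])

-- ... a centre s and leaves i ≠ j (a star at s, or the hub i with j hanging
-- on the other centre) ...
centrePairOK : Bool → ℕ → ℕ → Bool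
centrePairOK s i j =
  distinct (pick (leafProfile i) s ∷ pick (leafProfile j) s ∷ []) ∨
  distinct (pick (leafProfile i) false ∷ pick (leafProfile i) true ∷ pick (leafProfile j) (not s) ∷ [])

pairOK : ℕ → ℕ → Bool
pairOK i j = not (distinct (i ∷ j ∷ [])) ∨ all (λ s → centrePairOK s i j) sides

tripleOK : ℕ → ℕ → ℕ → Bool
tripleOK i j l = not (distinct (i ∷ j ∷ l ∷ [])) ∨ any (valid i j l) candidates

-- The checks succeed for all indices below 20, by evaluation.  The results
-- are opaque so that later uses do not unfold (and re-run) the checks.
opaque
  hubCertified : ∀ {i} → i < 20 → T (hubOK i)
  hubCertified = all-upTo hubOK 20 _

  pairCertified : ∀ {i j} → i < 20 → j < 20 → T (pairOK i j)
  pairCertified = all-upTo² pairOK 20 _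

  tripleCertified : ∀ {i j l} → i < 20 → j < 20 → l < 20 → T (tripleOK i j l)
  tripleCertified = all-upTo³ tripleOK 20 _

module Upper (t : ℕ) (9≤t : 9 ≤ t) (t≤20 : t ≤ 20) where
  open K2 t
  open Trees t

  -- the colouring of K_{2,t} given by leafColours; non-edges get colour 0
  colour : Vertex → Vertex → Fin 5
  colour fzero           (fsuc (fsuc a)) = proj₁ (leafColours (toℕ a))
  colour (fsuc fzero)    (fsuc (fsuc a)) = proj₂ (leafColours (toℕ a))
  colour (fsuc (fsuc a)) fzero           = proj₁ (leafColours (toℕ a))
  colour (fsuc (fsuc a)) (fsuc fzero)    = proj₂ (leafColours (toℕ a))
  colour _               _               = # 0

  colour-sym : ∀ u v → colour u v ≡ colour v u
  colour-sym fzero           fzero           = refl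
  colour-sym fzero           (fsuc fzero)    = refl
  colour-sym fzero           (fsuc (fsuc _)) = refl
  colour-sym (fsuc fzero)    fzero           = refl
  colour-sym (fsuc fzero)    (fsuc fzero)    = refl
  colour-sym (fsuc fzero)    (fsuc (fsuc _)) = refl
  colour-sym (fsuc (fsuc _)) fzero           = refl
  colour-sym (fsuc (fsuc _)) (fsuc fzero)    = refl
  colour-sym (fsuc (fsuc _)) (fsuc (fsuc _)) = refl

  C : Colouring (K2 t) 5
  C = record { col = colour ; colSym = colour-sym }

  RST : Vertex → Vertex → Vertex → Set
  RST = RainbowSTree (K2 t) C

  swap₁₂ : ∀ {x y z} → RST x y z → RST y x z
  swap₁₂ (V , E , tree , x∈ , y∈ , z∈ , rainbow) = V , E , tree , y∈ , x∈ , z∈ , rainbow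

  swap₂₃ : ∀ {x y z} → RST x y z → RST x z y
  swap₂₃ (V , E , tree , x∈ , y∈ , z∈ , rainbow) = V , E , tree , x∈ , z∈ , y∈ , rainbow

  legValue : Leg → ℕ
  legValue (a , s) = pick (leafProfile (toℕ a)) s

  legValue-colour : ∀ l → legValue l ≡ toℕ (colour (cen (proj₂ l)) (leaf (proj₁ l)))
  legValue-colour (a , false) = refl
  legValue-colour (a , true)  = refl

  legs-rainbow : ∀ ls → T (distinct (map legValue ls)) → Rainbow C (legEdges ls)
  legs-rainbow ls ok = AllPairsₚ.map⁺ coloursApart
    where
    valuesApart : AllPairs (λ l l' → legValue l ≢ legValue l') ls
    valuesApart = AllPairsₚ.map⁻ (distinct-sound (map legValue ls) ok)

    coloursApart : AllPairs (λ l l' → col C (cen (proj₂ l)) (leaf (proj₁ l)) ≢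
                                      col C (cen (proj₂ l')) (leaf (proj₁ l'))) ls
    coloursApart = AllPairs.map (λ {l} {l'} ne eq →
      ne (trans (legValue-colour l) (trans (cong toℕ eq) (≡.sym (legValue-colour l'))))) valuesApart

  index<20 : ∀ (a : Fin t) → toℕ a < 20
  index<20 a = ≤-trans (toℕ<n a) t≤20

  index-≢ : ∀ {a b} → leaf a ≢ leaf b → toℕ a ≢ toℕ b
  index-≢ ab = ab ∘ cong leaf ∘ toℕ-injective

  unique₃ : ∀ {x y z} → leaf x ≢ leaf y → leaf y ≢ leaf z → leaf x ≢ leaf z →
            Unique (leaf x ∷ leaf y ∷ leaf z ∷ [])
  unique₃ xy yz xz = (xy ∷ xz ∷ []) ∷ (yz ∷ []) ∷ [] ∷ []

  lone-hub : ∀ a → RST (cen false) (cen true) (leaf a)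
  lone-hub a = _ , _ , spiderTree a [] ([] ∷ []) , here refl , there (here refl) , there (there (here refl))
               , legs-rainbow (spiderLegs a []) (hubCertified (index<20 a))

  centres-leaf : ∀ s s' a → cen s ≢ cen s' → RST (cen s) (cen s') (leaf a)
  centres-leaf false false _ ne = ⊥-elim (ne refl)
  centres-leaf false true  a _  = lone-hub a
  centres-leaf true  false a _  = swap₁₂ (lone-hub a)
  centres-leaf true  true  _ ne = ⊥-elim (ne refl)

  centre-leaves : ∀ s a b → leaf a ≢ leaf b → RST (cen s) (leaf a) (leaf b)
  centre-leaves s a b ab
    with Equivalence.to T-∨ (pairCertified (index<20 a) (index<20 b))
  ... | inj₁ same = ⊥-elim (not-T same (distinct-complete ((index-≢ ab ∷ []) ∷ [] ∷ [])))
  ... | inj₂ bothSides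
    with Equivalence.to T-∨ (All.lookup (all⁺ (λ s → centrePairOK s (toℕ a) (toℕ b)) sides bothSides) (side∈ s))
  ... | inj₁ starOK =
    _ , _ , starTree s ((a , s) ∷ (b , s) ∷ []) (refl ∷ refl ∷ []) ((ab ∷ []) ∷ [] ∷ [])
      , here refl , there (here refl) , there (there (here refl)) , legs-rainbow _ starOK
  ... | inj₂ spiderOK =
    _ , _ , spiderTree a ((b , not s) ∷ []) ((ab ∷ []) ∷ [] ∷ [])
      , centre∈ s , there (there (here refl)) , there (there (there (here refl))) , legs-rainbow _ spiderOK
    where
    centre∈ : ∀ s → cen s ∈ cen false ∷ cen true ∷ leaf a ∷ leaf b ∷ []
    centre∈ false = here refl
    centre∈ true  = there (here refl)

  certificate : ∀ a b d → leaf a ≢ leaf b → leaf b ≢ leaf d → leaf a ≢ leaf d →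
                ∃ λ cert → T (valid (toℕ a) (toℕ b) (toℕ d) cert)
  certificate a b d ab bd ad
    with Equivalence.to T-∨ (tripleCertified (index<20 a) (index<20 b) (index<20 d))
  ... | inj₁ same = ⊥-elim (not-T same (distinct-complete
          ((index-≢ ab ∷ index-≢ ad ∷ []) ∷ (index-≢ bd ∷ []) ∷ [] ∷ [])))
  ... | inj₂ some = satisfied (any⁻ _ candidates some)

  hub-inside : ∀ {s₁ s₂} x y z → leaf x ≢ leaf y → leaf y ≢ leaf z → leaf x ≢ leaf z →
               T (hubFirst s₁ s₂ (leafProfile (toℕ x)) (leafProfile (toℕ y)) (leafProfile (toℕ z))) →
               RST (leaf x) (leaf y) (leaf z)
  hub-inside {s₁} {s₂} x y z xy yz xz ok =
    _ , _ , spiderTree x ((y , s₁) ∷ (z , s₂) ∷ []) (unique₃ xy yz xz)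
      , there (there (here refl)) , there (there (there (here refl)))
      , there (there (there (there (here refl)))) , legs-rainbow _ ok

  hub<t : ∀ {w i j l} → T (hubInRange w i j l) → i < t → j < t → l < t → w < t
  hub<t {w} {i} {j} {l} inRange i<t j<t l<t with Equivalence.to T-∨ inRange
  ... | inj₁ w<9   = <-≤-trans (<ᵇ⇒< w 9 w<9) 9≤t
  ... | inj₂ w≤max = ≤-<-trans (≤ᵇ⇒≤ w (i ⊔ j ⊔ l) w≤max) (⊔-lub (⊔-lub i<t j<t) l<t)

  hub-outside : ∀ {w s₁ s₂ s₃} a b d → leaf a ≢ leaf b → leaf b ≢ leaf d → leaf a ≢ leaf d →
                T (valid (toℕ a) (toℕ b) (toℕ d) (viaOutside w s₁ s₂ s₃)) →
                RST (leaf a) (leaf b) (leaf d)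
  hub-outside {w} {s₁} {s₂} {s₃} a b d ab bd ad ok
    with apart , inRange,colours ← Equivalence.to T-∧ ok
    with inRange , colours ← Equivalence.to T-∧ inRange,colours
    with (w≢a ∷ w≢b ∷ w≢d ∷ []) ∷ _ ← distinct-sound (w ∷ toℕ a ∷ toℕ b ∷ toℕ d ∷ []) apart
    = _ , _ , spiderTree hub ((a , s₁) ∷ (b , s₂) ∷ (d , s₃) ∷ [])
                             ((hub≢ w≢a ∷ hub≢ w≢b ∷ hub≢ w≢d ∷ []) ∷ unique₃ ab bd ad)
        , there (there (there (here refl))) , there (there (there (there (here refl))))
        , there (there (there (there (there (here refl)))))
        , legs-rainbow _ (subst (λ k → T (hubOutside k s₁ s₂ s₃ _ _ _)) (≡.sym (toℕ-fromℕ< w<t)) colours)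
    where
    w<t = hub<t inRange (toℕ<n a) (toℕ<n b) (toℕ<n d)
    hub = fromℕ< w<t
    hub≢ : ∀ {x} → w ≢ toℕ x → leaf hub ≢ leaf x
    hub≢ w≢x eq = w≢x (trans (≡.sym (toℕ-fromℕ< w<t)) (cong toℕ (leaf-injective eq)))

  leaves-rst : ∀ a b d → leaf a ≢ leaf b → leaf b ≢ leaf d → leaf a ≢ leaf d →
               RST (leaf a) (leaf b) (leaf d)
  leaves-rst a b d ab bd ad with certificate a b d ab bd ad
  ... | viaStar s , ok =
    _ , _ , starTree s ((a , s) ∷ (b , s) ∷ (d , s) ∷ []) (refl ∷ refl ∷ refl ∷ []) (unique₃ ab bd ad)
      , there (here refl) , there (there (here refl)) , there (there (there (here refl))) , legs-rainbow _ ok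
  ... | viaFirst s₁ s₂ , ok  = hub-inside {s₁} {s₂} a b d ab bd ad ok
  ... | viaSecond s₁ s₂ , ok = swap₁₂ (hub-inside {s₁} {s₂} b a d (ab ∘ ≡.sym) ad bd ok)
  ... | viaThird s₁ s₂ , ok  = swap₂₃ (swap₁₂ (hub-inside {s₁} {s₂} d a b (ad ∘ ≡.sym) ab (bd ∘ ≡.sym) ok))
  ... | viaOutside w s₁ s₂ s₃ , ok = hub-outside {w} {s₁} {s₂} {s₃} a b d ab bd ad ok

  is3Rainbow : Is3Rainbow (K2 t) C
  is3Rainbow x y z x≢y y≢z x≢z with kind x | kind y | kind z
  ... | centre s | centre s' | centre s″ =
    ⊥-elim (no-three-centres (cen-isCentre s) (cen-isCentre s') (cen-isCentre s″) x≢y y≢z x≢z)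
  ... | centre s | centre s' | leafK a = centres-leaf s s' a x≢y
  ... | centre s | leafK a   | centre s' = swap₂₃ (centres-leaf s s' a x≢z)
  ... | leafK a  | centre s  | centre s' = swap₁₂ (swap₂₃ (centres-leaf s s' a y≢z))
  ... | centre s | leafK a   | leafK b  = centre-leaves s a b y≢z
  ... | leafK a  | centre s  | leafK b  = swap₁₂ (centre-leaves s a b x≢z)
  ... | leafK a  | leafK b   | centre s = swap₂₃ (swap₁₂ (centre-leaves s a b x≢y))
  ... | leafK a  | leafK b   | leafK d  = leaves-rst a b d x≢y y≢z x≢z

five-colours : ∀ {t} → 9 ≤ t → t ≤ 20 → Has3RainbowColouring (K2 t) 5
five-colours {t} 9≤t t≤20 = Upper.C t 9≤t t≤20 , Upper.is3Rainbow t 9≤t t≤20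

lemma2p5 : ((t : ℕ) → 9 ≤ t → t ≤ 20 → Rx3≡ (K2 t) 5)
         × ((t : ℕ) → 21 ≤ t → Rx3≥ (K2 t) 6)
lemma2p5 = (λ t 9≤t t≤20 → five-colours 9≤t t≤20 , λ j j<5 → fewer-than-five 9≤t j<5)
         , (λ t 21≤t → fewer-than-six 21≤t)
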